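{- Let $k\in\mathbb{N}$, let $f:[\mathbb{N}]^2\rightarrow\{1,\dots,k\}$ be computable and $\phi:\mathbb{N}\rightarrow\mathbb{N}$ computable with $w\rightarrow(\phi(w))^2_{k+1}$ for all $w$ and $\liminf_w\phi(w)=\infty$. Then $\mathbb{N}$ is large (with respect to $f,\phi$).
   Context: $w\rightarrow(m)^2_j$ means every $j$-coloring of the 2-element subsets of a $w$-element set has a subset of size $m$ all of whose pairs have the same color. A set $X\subseteq\mathbb{N}$ is large (with respect to $f,\phi$) if for all $m,p\in\mathbb{N}$ there is $w\in\mathbb{N}$ such that for every $\rho:\{1,\dots,w\}\rightarrow\{1,\dots,p\}$ there exists $Y\subseteq(m,w]\cap X$ with $|Y|\geq\phi(w)$, $Y$ homogeneous for $f$ (all pairs from $Y$ get the same $f$-color), and $\rho$ constant on $Y$. A set is small if it is not large. -}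

module Defs where

open import Data.Nat using (ℕ; _≤_; _<_; _≥_)
open import Data.Fin using (Fin)
open import Data.List using (List; length)
open import Data.List.Membership.Propositional using (_∈_)
open import Data.List.Relation.Unary.All using (All)
open import Data.List.Relation.Unary.Unique.Propositional using (Unique)
open import Data.Product using (Σ; _×_; ∃)
open import Relation.Binary.PropositionalEquality using (_≡_)

-- A colouring of 2-element subsets {a,b} (a < b) of ℕ with colours in Fin j
-- (colours 0..j-1 stand for 1..j). The value c a b is only consulted for a < b.
PairColouring : ℕ → Set
PairColouring j = ℕ → ℕ → Fin j

Homogeneous : ∀ {j} → PairColouring j → List ℕ → Set
Homogeneous c Y = ∀ {a b x y} → a ∈ Y → b ∈ Y → x ∈ Y → y ∈ Y →
                  a < b → x < y → c a b ≡ c x y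

Arrow : ℕ → ℕ → ℕ → Set
Arrow w m j = (c : PairColouring j) →
  Σ (List ℕ) λ Y → Unique Y × All (λ y → 1 ≤ y × y ≤ w) Y ×
                   length Y ≡ m × Homogeneous c Y

LiminfInfinite : (ℕ → ℕ) → Set
LiminfInfinite φ = ∀ M → ∃ λ N → ∀ w → w ≥ N → φ w ≥ M

-- X ⊆ ℕ is large with respect to f, φ.
-- ρ : {1,…,w} → {1,…,p} is represented by a function ℕ → ℕ whose values on
-- 1..w lie in 1..p (values elsewhere are irrelevant).
Large : ∀ {k} → PairColouring k → (ℕ → ℕ) → (ℕ → Set) → Set
Large f φ X = ∀ m p → ∃ λ w →
  (ρ : ℕ → ℕ) → (∀ i → 1 ≤ i → i ≤ w → 1 ≤ ρ i × ρ i ≤ p) →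
  Σ (List ℕ) λ Y → Unique Y
    × All (λ y → (m < y × y ≤ w) × X y) Y
    × length Y ≥ φ w
    × Homogeneous f Y
    × (∀ {a b} → a ∈ Y → b ∈ Y → ρ a ≡ ρ b)

{-# OPTIONS --safe #-}
module Submission where

-- Given m, p and ρ, colour a pair a < b with 1 + f(a,b) if m < a and
-- ρ(a) = ρ(b), and with 0 otherwise; this is a (k+1)-colouring. Take w with
-- φ(w) > m + p + 2 and a homogeneous set Y of size φ(w). Pigeonholing Y into
-- the m + p + 2 classes "y ≤ m, by value" and "y > m, by ρ(y)" yields a pair
-- of nonzero colour, so every pair of Y has nonzero colour, which is exactly
-- the required Y ⊆ (m, w], f-homogeneous and ρ-constant.

open import Defs
open import Data.Nat using (ℕ; suc; _+_; _≤_; _<_; s≤s; _<?_; _≤?_)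
open import Data.Nat.Properties
open import Data.Unit using (⊤; tt)
open import Data.Fin as Fin using (Fin; fromℕ<)
open import Data.Fin.Properties using (pigeonhole; fromℕ<-injective)
open import Data.List using (List; _∷_; length; lookup)
open import Data.List.Membership.Propositional using (_∈_)
open import Data.List.Membership.Propositional.Properties using (∈-lookup)
open import Data.List.Relation.Unary.All as All using (All)
open import Data.List.Relation.Unary.AllPairs using (_∷_)
open import Data.List.Relation.Unary.Unique.Propositional using (Unique)
open import Data.Product using (_×_; ∃₂; _,_; proj₁; proj₂)
open import Relation.Nullary using (yes; no; contradiction)
open import Relation.Binary using (tri<; tri≈; tri>)
open import Relation.Binary.PropositionalEquality

Unique-lookup-≢ : ∀ {A : Set} {xs : List A} → Unique xs →
  ∀ {i j : Fin (length xs)} → i Fin.< j → lookup xs i ≢ lookup xs j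
Unique-lookup-≢ {xs = _ ∷ _} (x∉xs ∷ _) {Fin.zero}  {Fin.suc j} _         = All.lookup x∉xs (∈-lookup j)
Unique-lookup-≢ {xs = _ ∷ _} (_ ∷ uxs)  {Fin.suc i} {Fin.suc j} (s≤s i<j) = Unique-lookup-≢ uxs i<j

pigeonhole-∈ : ∀ {n} (g : ℕ → ℕ) {Y : List ℕ} → Unique Y → n < length Y →
  (∀ {y} → y ∈ Y → g y < n) → ∃₂ λ a b → a ∈ Y × b ∈ Y × a < b × g a ≡ g b
pigeonhole-∈ g {Y} uY n<|Y| g<n
  with i , j , i<j , gᵢ≡gⱼ ← pigeonhole n<|Y| (λ i → fromℕ< (g<n (∈-lookup i)))
  with <-cmp (lookup Y i) (lookup Y j)
... | tri< lt _ _ = _ , _ , ∈-lookup i , ∈-lookup j , lt , fromℕ<-injective _ _ _ _ gᵢ≡gⱼ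
... | tri≈ _ eq _ = contradiction eq (Unique-lookup-≢ uY i<j)
... | tri> _ _ gt = _ , _ , ∈-lookup j , ∈-lookup i , gt , sym (fromℕ<-injective _ _ _ _ gᵢ≡gⱼ)

pairwise⇒constant : ∀ {A : Set} (h : ℕ → A) {Y : List ℕ} →
  (∀ {x y} → x ∈ Y → y ∈ Y → x < y → h x ≡ h y) →
  ∀ {a b} → a ∈ Y → b ∈ Y → h a ≡ h b
pairwise⇒constant h pairwise {a} {b} a∈Y b∈Y with <-cmp a b
... | tri< a<b _ _ = pairwise a∈Y b∈Y a<b
... | tri≈ _ refl _ = refl
... | tri> _ _ b<a = sym (pairwise b∈Y a∈Y b<a)

module _ {k : ℕ} (f : PairColouring k) (m : ℕ) (ρ : ℕ → ℕ) where

  refine : PairColouring (suc k)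
  refine a b with m <? a | ρ a ≟ ρ b
  ... | yes _ | yes _ = Fin.suc (f a b)
  ... | _     | _     = Fin.zero

  refine-suc : ∀ {a b} → m < a → ρ a ≡ ρ b → refine a b ≡ Fin.suc (f a b)
  refine-suc {a} {b} m<a ρa≡ρb with m <? a | ρ a ≟ ρ b
  ... | yes _   | yes _     = refl
  ... | no m≮a  | _         = contradiction m<a m≮a
  ... | yes _   | no ρa≢ρb  = contradiction ρa≡ρb ρa≢ρb

  refine-suc⁻¹ : ∀ {a b q} → refine a b ≡ Fin.suc q → m < a × ρ a ≡ ρ b × f a b ≡ q
  refine-suc⁻¹ {a} {b} eq with m <? a | ρ a ≟ ρ b
  refine-suc⁻¹ refl | yes m<a | yes ρa≡ρb = m<a , ρa≡ρb , refl

  slot : ℕ → ℕ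
  slot y with y ≤? m
  ... | yes _ = y
  ... | no _  = suc (m + ρ y)

  slot-≤ : ∀ {p y} → ρ y ≤ p → slot y ≤ suc (m + p)
  slot-≤ {p} {y} ρy≤p with y ≤? m
  ... | yes y≤m = ≤-trans y≤m (≤-trans (m≤m+n m p) (n≤1+n (m + p)))
  ... | no _    = s≤s (+-monoʳ-≤ m ρy≤p)

  slot-collision : ∀ {a b} → a < b → slot a ≡ slot b → m < a × ρ a ≡ ρ b
  slot-collision {a} {b} a<b eq with a ≤? m | b ≤? m
  ... | yes _   | yes _   = contradiction eq (<⇒≢ a<b)
  ... | yes a≤m | no _    = contradiction (subst (m <_) (sym eq) (s≤s (m≤m+n m (ρ b)))) (≤⇒≯ a≤m)
  ... | no a≰m  | yes b≤m = contradiction (≤-trans b≤m (<⇒≤ (≰⇒> a≰m))) (<⇒≱ a<b)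
  ... | no a≰m  | no _    = ≰⇒> a≰m , +-cancelˡ-≡ m _ _ (suc-injective eq)

  refine-homogeneous⇒pairwise : ∀ {Y x₀ y₀} → Homogeneous refine Y →
    x₀ ∈ Y → y₀ ∈ Y → x₀ < y₀ → m < x₀ → ρ x₀ ≡ ρ y₀ →
    ∀ {x y} → x ∈ Y → y ∈ Y → x < y → m < x × ρ x ≡ ρ y × f x y ≡ f x₀ y₀
  refine-homogeneous⇒pairwise homogeneous x₀∈Y y₀∈Y x₀<y₀ m<x₀ ρx₀≡ρy₀ x∈Y y∈Y x<y =
    refine-suc⁻¹ (trans (homogeneous x∈Y y∈Y x₀∈Y y₀∈Y x<y x₀<y₀) (refine-suc m<x₀ ρx₀≡ρy₀))

  refine-homogeneous⇒good : ∀ {p Y} → Unique Y → (∀ {y} → y ∈ Y → ρ y ≤ p) →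
    suc (suc (suc (m + p))) ≤ length Y → Homogeneous refine Y →
    (∀ {y} → y ∈ Y → m < y) × Homogeneous f Y × (∀ {a b} → a ∈ Y → b ∈ Y → ρ a ≡ ρ b)
  refine-homogeneous⇒good {p} {Y} uY ρ≤p long homogeneous
    with x₀ , y₀ , x₀∈Y , y₀∈Y , x₀<y₀ , same-slot ←
           pigeonhole-∈ slot uY long (λ y∈Y → s≤s (slot-≤ (ρ≤p y∈Y)))
    with m<x₀ , ρx₀≡ρy₀ ← slot-collision x₀<y₀ same-slot
    = above-m , f-homogeneous , pairwise⇒constant ρ (λ x∈Y y∈Y x<y → proj₁ (proj₂ (good x∈Y y∈Y x<y)))
    where
    good : ∀ {x y} → x ∈ Y → y ∈ Y → x < y → m < x × ρ x ≡ ρ y × f x y ≡ f x₀ y₀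
    good = refine-homogeneous⇒pairwise homogeneous x₀∈Y y₀∈Y x₀<y₀ m<x₀ ρx₀≡ρy₀

    above-m : ∀ {y} → y ∈ Y → m < y
    above-m {y} y∈Y with y <? y₀
    ... | yes y<y₀ = proj₁ (good y∈Y y₀∈Y y<y₀)
    ... | no y≮y₀  = <-trans m<x₀ (<-≤-trans x₀<y₀ (≮⇒≥ y≮y₀))

    f-homogeneous : Homogeneous f Y
    f-homogeneous a∈Y b∈Y x∈Y y∈Y a<b x<y =
      trans (proj₂ (proj₂ (good a∈Y b∈Y a<b))) (sym (proj₂ (proj₂ (good x∈Y y∈Y x<y))))

lemma2p4 : (k : ℕ) (f : PairColouring k) (φ : ℕ → ℕ) →
    (∀ w → Arrow w (φ w) (suc k)) →
    LiminfInfinite φ →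
    Large f φ (λ _ → ⊤)
lemma2p4 k f φ arrow liminf m p .proj₁ = proj₁ (liminf (suc (suc (suc (m + p)))))
lemma2p4 k f φ arrow liminf m p .proj₂ ρ ρ-range
  with Y , uY , Y-range , |Y|≡φw , homogeneous ← arrow (lemma2p4 k f φ arrow liminf m p .proj₁) (refine f m ρ)
  with above-m , f-homogeneous , ρ-constant ←
         refine-homogeneous⇒good f m ρ uY
           (λ y∈Y → let 1≤y , y≤w = All.lookup Y-range y∈Y in proj₂ (ρ-range _ 1≤y y≤w))
           (subst (_ ≤_) (sym |Y|≡φw) (proj₂ (liminf _) _ ≤-refl)) homogeneous
  = Y , uY , All.tabulate (λ y∈Y → (above-m y∈Y , proj₂ (All.lookup Y-range y∈Y)) , tt)
      , ≤-reflexive (sym |Y|≡φw) , f-homogeneous , ρ-constant
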